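{- There is a function $C_4(t,\epsilon)$ such that the following holds for all $t\in\mathbb{N}$ and $0<\epsilon<1$: let $G$ be a bipartite graph with minimum degree $\delta(G)\geq C_4(t,\epsilon)$ which is induced $S_{t,t}$-free. Then for every path $x_1x_2x_3x_4x_5x_6$ of length $5$ in $G$ we have $|S_{N(x_1)}^{N(x_6)}(\epsilon)|\leq C_4(t,\epsilon)$.
   Context: $S_{t,t}$ is the graph with vertex set $\{x,x_1,\dots,x_t,y,y_1,\dots,y_t\}$ and edge set $\{xy\}\cup\{xy_1,\dots,xy_t\}\cup\{yx_1,\dots,yx_t\}$; induced $S_{t,t}$-free means no induced subgraph isomorphic to $S_{t,t}$. $N(v)$ is the neighbourhood of $v$. For vertex sets $X,Y$ and $\varepsilon\in(0,1)$, $S_X^Y(\varepsilon)=\{x\in X : |N(x)\cap Y|\leq (1-\varepsilon)|Y|\}$.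
   Formalization: The parameter ε ranges over the rationals in (0,1), so the function $C_4(t,\epsilon)$ is defined only for rational ε. -}

module Defs where

open import Data.Nat using (ℕ; zero; suc; _+_)
open import Data.Bool using (Bool; true; false; if_then_else_; _∧_; not)
open import Data.Fin using (Fin; zero; suc; inject₁)
open import Data.Integer using (+_)
open import Data.Rational using (ℚ; _/_; _≤ᵇ_; _-_; _*_; 1ℚ)
open import Relation.Binary.PropositionalEquality using (_≡_; _≢_)
open import Function.Definitions using (Injective)
open import Data.Product using (Σ)

record Graph (n : ℕ) : Set where
  field
    adj    : Fin n → Fin n → Bool
    sym    : ∀ u v → adj u v ≡ adj v u
    irrefl : ∀ v → adj v v ≡ false
open Graph public

count : ∀ {n} → (Fin n → Bool) → ℕ
count {zero}  f = 0
count {suc n} f = (if f zero then 1 else 0) + count (λ i → f (suc i))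

deg : ∀ {n} → Graph n → Fin n → ℕ
deg G v = count (adj G v)

codeg : ∀ {n} → Graph n → Fin n → Fin n → ℕ
codeg G u v = count (λ w → adj G u w ∧ adj G v w)

Bipartite : ∀ {n} → Graph n → Set
Bipartite {n} G = Σ (Fin n → Bool) λ c → ∀ u v → adj G u v ≡ true → c u ≢ c v

data SV (t : ℕ) : Set where
  vx vy : SV t
  vxi vyi : Fin t → SV t

sAdj : ∀ {t} → SV t → SV t → Bool
sAdj vx vy = true
sAdj vy vx = true
sAdj vx (vyi _) = true
sAdj (vyi _) vx = true
sAdj vy (vxi _) = true
sAdj (vxi _) vy = true
sAdj _ _ = false

InducedStt : ∀ {n} → ℕ → Graph n → Set
InducedStt {n} t G = Σ (SV t → Fin n) λ f →
  Injective _≡_ _≡_ f × (∀ u v → adj G (f u) (f v) ≡ sAdj u v)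
  where open import Data.Product using (_×_)

InducedSttFree : ∀ {n} → ℕ → Graph n → Set
InducedSttFree t G = InducedStt t G → ⊥
  where open import Data.Empty using (⊥)

IsPath6 : ∀ {n} → Graph n → (Fin 6 → Fin n) → Set
IsPath6 G p = Injective _≡_ _≡_ p × (∀ (i : Fin 5) → adj G (p (inject₁ i)) (p (suc i)) ≡ true)
  where open import Data.Product using (_×_)

ℕtoℚ : ℕ → ℚ
ℕtoℚ k = + k / 1

-- |S_X^Y(ε)| with X = N(a), Y = N(b):
-- #{ x ∈ N(a) : |N(x) ∩ N(b)| ≤ (1 - ε) |N(b)| }
sizeS : ∀ {n} → Graph n → ℚ → Fin n → Fin n → ℕ
sizeS G ε a b = count (λ x → adj G a x ∧ (ℕtoℚ (codeg G x b) ≤ᵇ ((1ℚ - ε) * ℕtoℚ (deg G b))))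

{-# OPTIONS --safe #-}
module Submission where

-- Call s k-far from b when s misses at least |N(b)|/k vertices of N(b); for ε = p/q every member
-- of S_{N(x₁)}^{N(x₆)}(ε) is q-far from x₆. If many neighbours of a were far from a neighbour b
-- of a, a greedy Kővári–Sós–Turán argument would find t of them and t neighbours of b with no
-- edges in between, which together with the edge ab form an induced S_{t,t}. Along the path, if
-- many neighbours of x₁ were far from x₆, discard the few that are far from x₂ (and the few
-- neighbours of x₆ far from x₅); the greedy argument then gives anticomplete t-sets X ⊆ N(x₁) and
-- Y ⊆ N(x₆). Each vertex of X misses less than a 1/4t-fraction of N(x₂), so some a ∈ N(x₂) sees
-- all of X and more than half of N(x₅); then some b ∈ N(x₅) ∩ N(a) sees all of Y, and the edge
-- ab completes an induced S_{t,t}. That few neighbours of x₂ are 2-far from x₅ follows from the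
-- same argument applied to x₂x₃x₄x₅.

open import Algebra.Properties.Semiring.Sum as Sum using ()
open import Data.Bool as Bool using (Bool; true; false; _∧_; not; if_then_else_; T)
open import Data.Bool.Properties
  using (∧-comm; ∧-zeroʳ; ∧-conicalˡ; ∧-conicalʳ; not-injective; not-involutive; ¬-not; T-≡)
open import Data.Empty using (⊥-elim)
open import Data.Fin using (Fin; zero; suc; inject≤)
open import Data.Fin.Patterns using (0F; 1F; 2F; 3F; 4F; 5F)
open import Data.Fin.Properties using (_≟_; suc-injective; any?; inject≤-injective)
open import Data.Integer as ℤ using (ℤ; +_; +<+; -[1+_])
import Data.Integer.Properties as ℤ
open import Data.Integer.Tactic.RingSolver using (solve-∀)
open import Data.List using (List; []; _∷_)
open import Data.List.Relation.Unary.All as All using (All)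
open import Data.Nat
  using (ℕ; zero; suc; _+_; _*_; _≤_; _<_; _≤ᵇ_; _≤?_; z≤n; s≤s; pred; NonZero; >-nonZero)
open import Data.Nat.Coprimality as Coprime using (1-coprimeTo)
open import Data.Nat.ListAction as ListAction using ()
open import Data.Nat.Properties
  using ( +-*-semiring; module ≤-Reasoning
        ; ≤-refl; ≤-reflexive; ≤-trans; <-≤-trans; <⇒≤; <⇒≱; ≰⇒>; <⇒≤pred; suc-pred; m≤n⇒m≤1+n
        ; +-comm; +-assoc; +-identityʳ; +-suc; m≤m+n; m≤n+m; m<n+m
        ; +-mono-≤; +-monoˡ-≤; +-monoʳ-≤; +-mono-≤-<; +-cancelˡ-≤; +-cancelˡ-<
        ; *-comm; *-assoc; *-zeroʳ; m≤n*m
        ; *-monoˡ-≤; *-monoʳ-≤; *-monoʳ-<; *-cancelˡ-≤; *-cancelˡ-<; ≤ᵇ⇒≤; ≤⇒≤ᵇ )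
open import Data.Nat.Tactic.RingSolver using (solve)
open import Data.Product using (Σ; ∃-syntax; _×_; _,_; proj₁; proj₂)
open import Data.Rational as ℚ using (ℚ; mkℚ; 0ℚ; 1ℚ; -_; toℚᵘ; ↧ₙ_)
import Data.Rational.Properties as ℚ
open import Data.Rational.Unnormalised as ℚᵘ using (mkℚᵘ; 1ℚᵘ; *≤*)
import Data.Rational.Unnormalised.Properties as ℚᵘ
open import Data.Unit using (tt)
open import Data.Vec.Functional as Vector using ()
open import Function using (_∘_; flip; Equivalence)
open import Function.Definitions using (Injective)
open import Relation.Binary.PropositionalEquality
open import Relation.Nullary using (does; yes; no; _×-dec_; contradiction)
open import Relation.Nullary.Decidable using (dec-true)

open import Defs hiding (sym)
open Sum +-*-semiring using (sum; sum-cong-≗; ∑-comm; *-distribˡ-sum)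

private variable
  n m : ℕ

-- Counting in vertex sets

infixl 7 _∩_ _∖_
infix 4 _⊆_

_∩_ _∖_ : (Fin n → Bool) → (Fin n → Bool) → Fin n → Bool
(P ∩ Q) v = P v ∧ Q v
(P ∖ Q) v = P v ∧ not (Q v)

_⊆_ : (Fin n → Bool) → (Fin n → Bool) → Set
P ⊆ Q = ∀ v → P v ≡ true → Q v ≡ true

⁅_⁆ : Fin n → Fin n → Bool
⁅ w ⁆ v = does (v ≟ w)

⋂ : (Fin m → Fin n → Bool) → Fin n → Bool
⋂ {m = zero}  Q v = true
⋂ {m = suc m} Q v = Q zero v ∧ ⋂ (Q ∘ suc) v

⋂-true : (Q : Fin m → Fin n → Bool) {v : Fin n} → ⋂ Q v ≡ true → ∀ i → Q i v ≡ true
⋂-true Q h zero    = ∧-conicalˡ _ _ h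
⋂-true Q h (suc i) = ⋂-true (Q ∘ suc) (∧-conicalʳ _ _ h) i

count-cong : {P Q : Fin n → Bool} → (∀ v → P v ≡ Q v) → count P ≡ count Q
count-cong {zero}  _   = refl
count-cong {suc n} P≗Q =
  cong₂ _+_ (cong (λ b → if b then 1 else 0) (P≗Q zero)) (count-cong (P≗Q ∘ suc))

count-false : count {n} (λ _ → false) ≡ 0
count-false {zero}  = refl
count-false {suc n} = count-false {n}

count-⁅⁆ : (w : Fin n) → count ⁅ w ⁆ ≡ 1
count-⁅⁆ {suc n} zero    = cong suc (count-false {n})
count-⁅⁆         (suc w) = count-⁅⁆ w

count-mono : {P Q : Fin n → Bool} → P ⊆ Q → count P ≤ count Q
count-mono {zero}          _   = z≤n
count-mono {suc n} {P} {Q} P⊆Q with P zero in p | Q zero in q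
... | true  | true  = s≤s (count-mono (P⊆Q ∘ suc))
... | true  | false with () ← trans (sym q) (P⊆Q zero p)
... | false | true  = m≤n⇒m≤1+n (count-mono (P⊆Q ∘ suc))
... | false | false = count-mono (P⊆Q ∘ suc)

count-split : (P Q : Fin n → Bool) → count P ≡ count (P ∩ Q) + count (P ∖ Q)
count-split {zero}  _ _ = refl
count-split {suc n} P Q with P zero | Q zero
... | true  | true  = cong suc (count-split (P ∘ suc) (Q ∘ suc))
... | true  | false = trans (cong suc (count-split (P ∘ suc) (Q ∘ suc))) (sym (+-suc _ _))
... | false | _     = count-split (P ∘ suc) (Q ∘ suc)

count-cover : {P Q R : Fin n → Bool} → (∀ v → P v ≡ true → Q v ≡ false → R v ≡ true) →
              count P ≤ count Q + count R
count-cover {P = P} {Q} {R} cover = begin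
  count P                        ≡⟨ count-split P Q ⟩
  count (P ∩ Q) + count (P ∖ Q)  ≤⟨ +-mono-≤ (count-mono (λ v → ∧-conicalʳ (P v) (Q v)))
                                             (count-mono P∖Q⊆R) ⟩
  count Q + count R              ∎
  where
  open ≤-Reasoning
  P∖Q⊆R : P ∖ Q ⊆ R
  P∖Q⊆R v h = cover v (∧-conicalˡ _ _ h) (not-injective (∧-conicalʳ _ _ h))

count-∖∩ : (P Q R : Fin n → Bool) → count (P ∖ (Q ∩ R)) ≤ count (P ∖ Q) + count (P ∖ R)
count-∖∩ P Q R = count-cover (λ v → cover (P v) (Q v) (R v))
  where
  cover : ∀ p q r → p ∧ not (q ∧ r) ≡ true → p ∧ not q ≡ false → p ∧ not r ≡ true
  cover true true false _ _ = refl

count-∖≤∩+∖∖ : (P Q R : Fin n → Bool) → count (P ∖ R) ≤ count (P ∩ Q) + count (P ∖ Q ∖ R)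
count-∖≤∩+∖∖ P Q R = count-cover (λ v → cover (P v) (Q v) (R v))
  where
  cover : ∀ p q r → p ∧ not r ≡ true → p ∧ q ≡ false → (p ∧ not q) ∧ not r ≡ true
  cover true false false _ _ = refl

∈⇒0<count : (P : Fin n → Bool) (v : Fin n) → P v ≡ true → 0 < count P
∈⇒0<count P zero    Pv rewrite Pv = s≤s z≤n
∈⇒0<count P (suc v) Pv = ≤-trans (∈⇒0<count (P ∘ suc) v Pv) (m≤n+m _ _)

0<count⇒∃ : (P : Fin n → Bool) → 0 < count P → ∃[ v ] P v ≡ true
0<count⇒∃ {suc n} P pos with P zero in p
... | true  = zero , p
... | false with 0<count⇒∃ (P ∘ suc) pos
...   | v , Pv = suc v , Pv

count∖+count∩<count⇒∃ : (P A F : Fin n → Bool) → count (P ∖ A) + count (P ∩ F) < count P →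
                        ∃[ v ] (P ∩ A ∖ F) v ≡ true
count∖+count∩<count⇒∃ P A F small = 0<count⇒∃ (P ∩ A ∖ F) (+-cancelˡ-< (X + Y) 0 Z (begin-strict
  X + Y + 0          ≡⟨ +-identityʳ (X + Y) ⟩
  X + Y              <⟨ small ⟩
  count P            ≡⟨ count-split P A ⟩
  count (P ∩ A) + X  ≤⟨ +-monoˡ-≤ X (count-cover (λ v → cover (P v) (A v) (F v))) ⟩
  Y + Z + X          ≡⟨ trans (+-comm (Y + Z) X) (sym (+-assoc X Y Z)) ⟩
  X + Y + Z          ∎))
  where
  open ≤-Reasoning
  X = count (P ∖ A)
  Y = count (P ∩ F)
  Z = count (P ∩ A ∖ F)
  cover : ∀ p a f → p ∧ a ≡ true → p ∧ f ≡ false → (p ∧ a) ∧ not f ≡ true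
  cover true true false _ _ = refl

enumerate : (P : Fin n → Bool) → Fin (count P) → Fin n
enumerate {suc n} P i with P zero
enumerate {suc n} P zero    | true  = zero
enumerate {suc n} P (suc i) | true  = suc (enumerate (P ∘ suc) i)
enumerate {suc n} P i       | false = suc (enumerate (P ∘ suc) i)

enumerate-∈ : (P : Fin n → Bool) (i : Fin (count P)) → P (enumerate P i) ≡ true
enumerate-∈ {suc n} P i with P zero in p
enumerate-∈ {suc n} P zero    | true  = p
enumerate-∈ {suc n} P (suc i) | true  = enumerate-∈ (P ∘ suc) i
enumerate-∈ {suc n} P i       | false = enumerate-∈ (P ∘ suc) i

enumerate-injective : (P : Fin n → Bool) → Injective _≡_ _≡_ (enumerate P)
enumerate-injective {suc n} P {i} {j} e with P zero
enumerate-injective {suc n} P {zero}  {zero}  e | true  = refl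
enumerate-injective {suc n} P {suc i} {suc j} e | true  =
  cong suc (enumerate-injective (P ∘ suc) (suc-injective e))
enumerate-injective {suc n} P {i}     {j}     e | false =
  enumerate-injective (P ∘ suc) (suc-injective e)

∷-injective : {A : Set} {x : A} {xs : Fin n → A} → Injective _≡_ _≡_ xs → (∀ i → xs i ≢ x) →
              Injective _≡_ _≡_ (x Vector.∷ xs)
∷-injective _   _     {zero}  {zero}  _ = refl
∷-injective _   fresh {zero}  {suc j} e = contradiction (sym e) (fresh j)
∷-injective _   fresh {suc i} {zero}  e = contradiction e (fresh i)
∷-injective inj _     {suc i} {suc j} e = cong suc (inj e)

count≡sum : (P : Fin n → Bool) → count P ≡ sum (λ v → if P v then 1 else 0)
count≡sum {zero}  _ = refl
count≡sum {suc n} P = cong₂ _+_ refl (count≡sum (P ∘ suc))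

double-counting : (M : Fin n → Fin m → Bool) →
                  sum (λ s → count (M s)) ≡ sum (λ w → count (λ s → M s w))
double-counting M = begin
  sum (λ s → count (M s))                         ≡⟨ sum-cong-≗ (count≡sum ∘ M) ⟩
  sum (λ s → sum (λ w → if M s w then 1 else 0))  ≡⟨ ∑-comm (λ s w → if M s w then 1 else 0) ⟩
  sum (λ w → sum (λ s → if M s w then 1 else 0))  ≡⟨ sum-cong-≗ (λ w → sym (count≡sum (λ s → M s w))) ⟩
  sum (λ w → count (λ s → M s w))                 ∎
  where open ≡-Reasoning

count*≤sum : (P : Fin n → Bool) {c : ℕ} {f : Fin n → ℕ} →
             (∀ v → P v ≡ true → c ≤ f v) → count P * c ≤ sum f
count*≤sum {zero}  _ _ = z≤n
count*≤sum {suc n} P {c} {f} lower with P zero in p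
... | true  = +-mono-≤ (lower zero p) (count*≤sum (P ∘ suc) (lower ∘ suc))
... | false = ≤-trans (count*≤sum (P ∘ suc) (lower ∘ suc)) (m≤n+m _ (f zero))

sum≤count* : (P : Fin n → Bool) {c : ℕ} {f : Fin n → ℕ} →
             (∀ v → P v ≡ true → f v ≤ c) → (∀ v → P v ≡ false → f v ≡ 0) → sum f ≤ count P * c
sum≤count* {zero}  _ _ _ = z≤n
sum≤count* {suc n} P {c} {f} upper zero-off with P zero in p
... | true  = +-mono-≤ (upper zero p) (sum≤count* (P ∘ suc) (upper ∘ suc) (zero-off ∘ suc))
... | false rewrite zero-off zero p = sum≤count* (P ∘ suc) (upper ∘ suc) (zero-off ∘ suc)

sum≤* : {f : Fin n → ℕ} {c : ℕ} → (∀ i → f i ≤ c) → sum f ≤ n * c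
sum≤* {zero}  _     = z≤n
sum≤* {suc n} upper = +-mono-≤ (upper zero) (sum≤* (upper ∘ suc))

count-∖⋂ : (P : Fin n → Bool) (Q : Fin m → Fin n → Bool) →
           count (P ∖ ⋂ Q) ≤ sum (λ i → count (P ∖ Q i))
count-∖⋂ {n = n} {m = zero}  P Q =
  ≤-reflexive (trans (count-cong (λ v → ∧-zeroʳ (P v))) (count-false {n}))
count-∖⋂         {m = suc m} P Q =
  ≤-trans (count-∖∩ P (Q zero) (⋂ (Q ∘ suc))) (+-monoʳ-≤ (count (P ∖ Q zero)) (count-∖⋂ P (Q ∘ suc)))

averaging : (R : Fin n → Fin m → Bool) (T : Fin n → Bool) (W : Fin m → Bool) {k D : ℕ} →
            1 ≤ D → count W ≤ D → 0 < count T →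
            (∀ s → T s ≡ true → D ≤ k * count (W ∩ R s)) →
            ∃[ w ] W w ≡ true × count T ≤ k * count (T ∩ flip R w)
averaging {n = n} {m = m} R T W {k} {D} D≥1 |W|≤D |T|>0 rows
  with any? (λ w → (W w Bool.≟ true) ×-dec (count T ≤? k * count (T ∩ flip R w)))
... | yes found = found
... | no none = ⊥-elim (<⇒≱ lt (begin
  count T * D                          ≤⟨ count*≤sum T row ⟩
  sum (λ s → k * count (M s))          ≡⟨ *-distribˡ-sum k (λ s → count (M s)) ⟨
  k * sum (λ s → count (M s))          ≡⟨ cong (k *_) (double-counting M) ⟩
  k * sum (λ w → count (λ s → M s w))  ≡⟨ *-distribˡ-sum k (λ w → count (λ s → M s w)) ⟩
  sum (λ w → k * count (λ s → M s w))  ≤⟨ sum≤count* W column column-off ⟩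
  count W * pred (count T)             ≤⟨ *-monoˡ-≤ (pred (count T)) |W|≤D ⟩
  D * pred (count T)                   ∎))
  where
  open ≤-Reasoning
  M : Fin n → Fin m → Bool
  M s w = T s ∧ (W w ∧ R s w)
  row : ∀ s → T s ≡ true → D ≤ k * count (M s)
  row s Ts = subst (λ x → D ≤ k * x) (count-cong (λ w → cong (_∧ (W w ∧ R s w)) (sym Ts))) (rows s Ts)
  column : ∀ w → W w ≡ true → k * count (λ s → M s w) ≤ pred (count T)
  column w Ww = <⇒≤pred (subst (λ x → k * x < count T)
                                (count-cong (λ s → cong (λ b → T s ∧ (b ∧ R s w)) (sym Ww)))
                                (≰⇒> (λ big → none (w , Ww , big))))
  column-off : ∀ w → W w ≡ false → k * count (λ s → M s w) ≡ 0
  column-off w w∉W = trans (cong (k *_) (trans (count-cong empty) (count-false {n}))) (*-zeroʳ k)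
    where
    empty : ∀ s → M s w ≡ false
    empty s = trans (cong (λ b → T s ∧ (b ∧ R s w)) w∉W) (∧-zeroʳ (T s))
  lt : D * pred (count T) < count T * D
  lt = begin-strict
    D * pred (count T)        ≡⟨ *-comm D (pred (count T)) ⟩
    pred (count T) * D        <⟨ m<n+m _ D≥1 ⟩
    suc (pred (count T)) * D  ≡⟨ cong (_* D) (suc-pred (count T) {{>-nonZero |T|>0}}) ⟩
    count T * D               ∎

greedyBound : ℕ → ℕ → ℕ → ℕ
greedyBound k zero    r = r
greedyBound k (suc j) r = suc (k * greedyBound k j r)

edgeBound : ℕ → ℕ → ℕ
edgeBound t k = greedyBound (2 * k) t t

pathBound : ℕ → ℕ → ℕ
pathBound t k = edgeBound t (4 * t) + edgeBound t k

degreeThresholds : ℕ → ℕ → List ℕ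
degreeThresholds t k =
  1 ∷ 2 * (4 * t) * t ∷ 2 * 2 * t ∷ 2 * edgeBound t 2 ∷ 2 * 2 * (edgeBound t (4 * t) + t)
    ∷ 2 * (edgeBound t (4 * t) + edgeBound t 2) ∷ 2 * k * (edgeBound t (4 * t) + t) ∷ []

greedy-margin : ∀ {D k j x y} → D + k * suc j ≤ k * x → x ≤ 1 + y → D + k * j ≤ k * y
greedy-margin {D} {k} {j} {x} {y} far x≤1+y = +-cancelˡ-≤ k _ _ (begin
  k + (D + k * j)  ≡⟨ solve (D ∷ k ∷ j ∷ []) ⟩
  D + k * suc j    ≤⟨ far ⟩
  k * x            ≤⟨ *-monoʳ-≤ k x≤1+y ⟩
  k * (1 + y)      ≡⟨ solve (k ∷ y ∷ []) ⟩
  k + k * y        ∎)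
  where open ≤-Reasoning

far-margin : ∀ {D k x M y t} → D ≤ k * x → x ≤ M + y → 2 * k * (M + t) ≤ D → D + 2 * k * t ≤ 2 * k * y
far-margin {D} {k} {x} {M} {y} {t} far x≤M+y margin = +-cancelˡ-≤ (2 * k * M) _ _ (begin
  2 * k * M + (D + 2 * k * t)  ≡⟨ solve (D ∷ k ∷ M ∷ t ∷ []) ⟩
  D + 2 * k * (M + t)          ≤⟨ +-monoʳ-≤ D margin ⟩
  D + D                        ≤⟨ +-mono-≤ far far ⟩
  k * x + k * x                ≤⟨ +-mono-≤ (*-monoʳ-≤ k x≤M+y) (*-monoʳ-≤ k x≤M+y) ⟩
  k * (M + y) + k * (M + y)    ≡⟨ solve (k ∷ M ∷ y ∷ []) ⟩
  2 * k * M + 2 * k * y        ∎)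
  where open ≤-Reasoning

quarter+half<whole : ∀ X Y {d} → 4 * X ≤ d → 2 * Y < d → X + Y < d
quarter+half<whole X Y {d} quarter half = *-cancelˡ-< 4 _ _ (begin-strict
  4 * (X + Y)          ≡⟨ solve (X ∷ Y ∷ []) ⟩
  4 * X + 2 * (2 * Y)  <⟨ +-mono-≤-< quarter (*-monoʳ-< 2 half) ⟩
  d + 2 * d            ≤⟨ m≤n+m (d + 2 * d) d ⟩
  4 * d                ∎)
  where open ≤-Reasoning

toℚᵘ-ℕtoℚ : ∀ c → toℚᵘ (ℕtoℚ c) ≡ mkℚᵘ (+ c) 0
toℚᵘ-ℕtoℚ c = cong toℚᵘ (ℚ.normalize-coprime (Coprime.sym (1-coprimeTo c)))

toℚᵘ-≤[1-ε] : ∀ {ε c d} → ℕtoℚ c ℚ.≤ (1ℚ ℚ.- ε) ℚ.* ℕtoℚ d →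
              mkℚᵘ (+ c) 0 ℚᵘ.≤ (1ℚᵘ ℚᵘ.- toℚᵘ ε) ℚᵘ.* mkℚᵘ (+ d) 0
toℚᵘ-≤[1-ε] {ε} {c} {d} le =
  subst (ℚᵘ._≤ _) (toℚᵘ-ℕtoℚ c) (ℚᵘ.≤-respʳ-≃ homo (ℚ.toℚᵘ-mono-≤ le))
  where
  homo : toℚᵘ ((1ℚ ℚ.- ε) ℚ.* ℕtoℚ d) ℚᵘ.≃ (1ℚᵘ ℚᵘ.- toℚᵘ ε) ℚᵘ.* mkℚᵘ (+ d) 0
  homo = ℚᵘ.≃-trans (ℚ.toℚᵘ-homo-* (1ℚ ℚ.- ε) (ℕtoℚ d))
           (ℚᵘ.*-cong (ℚᵘ.≃-trans (ℚ.toℚᵘ-homo-+ 1ℚ (- ε)) (ℚᵘ.+-congʳ 1ℚᵘ (ℚ.toℚᵘ-homo‿- ε)))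
                      (ℚᵘ.≃-reflexive (toℚᵘ-ℕtoℚ d)))

≤[1-ε]-cross-multiplied : ∀ c d p q →
  mkℚᵘ (+ c) 0 ℚᵘ.≤ (1ℚᵘ ℚᵘ.- mkℚᵘ (+ suc p) q) ℚᵘ.* mkℚᵘ (+ d) 0 → c * suc q + suc p * d ≤ suc q * d
≤[1-ε]-cross-multiplied c d p q (*≤* le) =
  ℤ.drop‿+≤+ (subst₂ ℤ._≤_ lhs rhs (ℤ.+-monoˡ-≤ (+ suc p ℤ.* + d) le))
  where
  open ≡-Reasoning
  -- lhs and rhs are the two sides of the ℚᵘ inequality, as *≤* unfolds them, plus (p + 1) d.
  identity : ∀ (Q P D : ℤ) → ((+ 1 ℤ.* Q ℤ.+ (ℤ.- P) ℤ.* + 1) ℤ.* D) ℤ.* + 1 ℤ.+ P ℤ.* D ≡ Q ℤ.* D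
  identity = solve-∀
  lhs : + c ℤ.* + (1 * suc q * 1) ℤ.+ + suc p ℤ.* + d ≡ + (c * suc q + suc p * d)
  lhs = begin
    + c ℤ.* + (1 * suc q * 1) ℤ.+ + suc p ℤ.* + d
      ≡⟨ cong (λ x → + c ℤ.* + x ℤ.+ + suc p ℤ.* + d) (solve (q ∷ [])) ⟩
    + c ℤ.* + suc q ℤ.+ + suc p ℤ.* + d
      ≡⟨ cong₂ ℤ._+_ (ℤ.pos-* c (suc q)) (ℤ.pos-* (suc p) d) ⟨
    + (c * suc q) ℤ.+ + (suc p * d)
      ≡⟨ ℤ.pos-+ (c * suc q) (suc p * d) ⟨
    + (c * suc q + suc p * d) ∎
  rhs : ((+ 1 ℤ.* + suc q ℤ.+ (ℤ.- + suc p) ℤ.* + 1) ℤ.* + d) ℤ.* + 1 ℤ.+ + suc p ℤ.* + d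
        ≡ + (suc q * d)
  rhs = trans (identity (+ suc q) (+ suc p) (+ d)) (sym (ℤ.pos-* (suc q) d))

-- For ε = p/q > 0 we have ε ≥ 1/q, and c ≤ (1 - ε)(c + m) says ε (c + m) ≤ m.
c≤[1-ε][c+m]⇒c+m≤↧ε*m : ∀ {ε c m} → 0ℚ ℚ.< ε → ℕtoℚ c ℚ.≤ (1ℚ ℚ.- ε) ℚ.* ℕtoℚ (c + m) →
                        c + m ≤ ↧ₙ ε * m
c≤[1-ε][c+m]⇒c+m≤↧ε*m {mkℚ (+ 0)     _ _} (ℚ.*<* (+<+ ())) _
c≤[1-ε][c+m]⇒c+m≤↧ε*m {mkℚ -[1+ _ ]  _ _} (ℚ.*<* ()) _
c≤[1-ε][c+m]⇒c+m≤↧ε*m {ε@(mkℚ (+ suc p) q _)} {c} {m} _ le = begin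
  c + m              ≤⟨ m≤n*m (c + m) (suc p) ⟩
  suc p * (c + m)    ≤⟨ +-cancelˡ-≤ (c * suc q) _ _ (begin
    c * suc q + suc p * (c + m)  ≤⟨ ≤[1-ε]-cross-multiplied c (c + m) p q (toℚᵘ-≤[1-ε] {ε} le) ⟩
    suc q * (c + m)              ≡⟨ solve (c ∷ m ∷ q ∷ []) ⟩
    c * suc q + suc q * m        ∎) ⟩
  suc q * m          ∎
  where open ≤-Reasoning

-- Far vertices and anticomplete pairs

module _ {n : ℕ} (G : Graph n) where

  N : Fin n → Fin n → Bool
  N = adj G

  -- In the paper's notation, Far k b s says s ∈ S_X^{N(b)}(1/k) for any X ∋ s.
  Far : ℕ → Fin n → Fin n → Bool
  Far k b s = deg G b ≤ᵇ k * count (N b ∖ N s)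

  Far⇒≤ : ∀ {k b s} → Far k b s ≡ true → deg G b ≤ k * count (N b ∖ N s)
  Far⇒≤ {k} {b} {s} far = ≤ᵇ⇒≤ (deg G b) (k * count (N b ∖ N s)) (subst T (sym far) tt)

  ¬Far⇒> : ∀ {k b s} → Far k b s ≡ false → k * count (N b ∖ N s) < deg G b
  ¬Far⇒> near = ≰⇒> (λ le → subst T near (≤⇒≤ᵇ le))

  ≤⇒Far : ∀ {k b s} → deg G b ≤ k * count (N b ∖ N s) → Far k b s ≡ true
  ≤⇒Far le = Equivalence.to T-≡ (≤⇒≤ᵇ le)

  adj-sym : ∀ {u v} → adj G u v ≡ true → adj G v u ≡ true
  adj-sym {u} {v} uv = trans (Graph.sym G v u) uv

  deg≡codeg+missed : ∀ s b → deg G b ≡ codeg G s b + count (N b ∖ N s)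
  deg≡codeg+missed s b =
    trans (count-split (N b) (N s))
          (cong (_+ count (N b ∖ N s)) (count-cong (λ w → ∧-comm (adj G b w) (adj G s w))))

  sizeS≤count-Far : ∀ {ε} → 0ℚ ℚ.< ε → ∀ a b → sizeS G ε a b ≤ count (N a ∩ Far (↧ₙ ε) b)
  sizeS≤count-Far {ε} ε>0 a b = count-mono λ s h →
    cong₂ _∧_ (∧-conicalˡ (adj G a s) _ h) (≤⇒Far {↧ₙ ε} {b} {s} (far s (∧-conicalʳ (adj G a s) _ h)))
    where
    far : ∀ s → (ℕtoℚ (codeg G s b) ℚ.≤ᵇ (1ℚ ℚ.- ε) ℚ.* ℕtoℚ (deg G b)) ≡ true →
          deg G b ≤ ↧ₙ ε * count (N b ∖ N s)
    far s h rewrite deg≡codeg+missed s b = c≤[1-ε][c+m]⇒c+m≤↧ε*m ε>0 (ℚ.≤ᵇ⇒≤ (subst T (sym h) tt))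

  record Anticomplete (T W : Fin n → Bool) (r j : ℕ) : Set where
    field
      left            : Fin r → Fin n
      right           : Fin j → Fin n
      left-injective  : Injective _≡_ _≡_ left
      right-injective : Injective _≡_ _≡_ right
      left⊆T          : ∀ i → T (left i) ≡ true
      right⊆W         : ∀ i → W (right i) ≡ true
      nonadjacent     : ∀ i i′ → adj G (left i) (right i′) ≡ false

  anticomplete-greedy : ∀ {k D r} j (T W : Fin n → Bool) → 1 ≤ D → count W ≤ D →
    (∀ s → T s ≡ true → D + k * j ≤ k * count (W ∖ N s)) →
    greedyBound k j r ≤ count T → Anticomplete T W r j
  anticomplete-greedy zero T W _ _ _ r≤|T| = record
    { left            = λ i → enumerate T (inject≤ i r≤|T|)
    ; right           = λ ()
    ; left-injective  = λ e → inject≤-injective _ _ _ _ (enumerate-injective T e)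
    ; right-injective = λ { {()} }
    ; left⊆T          = λ i → enumerate-∈ T _
    ; right⊆W         = λ ()
    ; nonadjacent     = λ _ () }
  anticomplete-greedy {k} {D} {r} (suc j) T W D≥1 |W|≤D far big
    with averaging (λ s w → not (adj G s w)) T W {k} {D} D≥1 |W|≤D (≤-trans (s≤s z≤n) big)
                   (λ s Ts → ≤-trans (m≤m+n D _) (far s Ts))
  ... | w , Ww , |T|≤k|T′| = record
    { left            = left
    ; right           = w Vector.∷ right
    ; left-injective  = left-injective
    ; right-injective = ∷-injective right-injective fresh
    ; left⊆T          = λ i → ∧-conicalˡ _ _ (left⊆T i)
    ; right⊆W         = λ { zero → Ww ; (suc i) → ∧-conicalˡ _ _ (right⊆W i) }
    ; nonadjacent     = λ { i zero → not-injective (∧-conicalʳ _ _ (left⊆T i))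
                          ; i (suc i′) → nonadjacent i i′ } }
    where
    T′ W′ : Fin n → Bool
    T′ = T ∩ (λ s → not (adj G s w))
    W′ = W ∖ ⁅ w ⁆
    far′ : ∀ s → T′ s ≡ true → D + k * j ≤ k * count (W′ ∖ N s)
    far′ s T′s = greedy-margin {D} {k} {j} (far s (∧-conicalˡ _ _ T′s)) (begin
      count (W ∖ N s)                      ≤⟨ count-∖≤∩+∖∖ W ⁅ w ⁆ (N s) ⟩
      count (W ∩ ⁅ w ⁆) + count (W′ ∖ N s) ≤⟨ +-monoˡ-≤ _ (count-mono (λ v → ∧-conicalʳ (W v) _)) ⟩
      count ⁅ w ⁆ + count (W′ ∖ N s)       ≡⟨ cong (_+ count (W′ ∖ N s)) (count-⁅⁆ w) ⟩
      1 + count (W′ ∖ N s)                 ∎)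
      where open ≤-Reasoning
    rest : Anticomplete T′ W′ r j
    rest = anticomplete-greedy j T′ W′ D≥1 (≤-trans (count-mono (λ v → ∧-conicalˡ (W v) _)) |W|≤D) far′
             (<⇒≤ (*-cancelˡ-< k _ _ (≤-trans big |T|≤k|T′|)))
    open Anticomplete rest
    fresh : ∀ i → right i ≢ w
    fresh i e = contradiction (trans (sym (dec-true (right i ≟ w) e))
                                     (not-injective (∧-conicalʳ _ _ (right⊆W i)))) λ ()

  module DoubleStar {t a b} {T W : Fin n → Bool} (bip : Bipartite G) (ab : adj G a b ≡ true)
    (A : Anticomplete T W t t)
    (a~left : ∀ i → adj G a (Anticomplete.left A i) ≡ true)
    (b~right : ∀ i → adj G b (Anticomplete.right A i) ≡ true) where

    open Anticomplete A

    colour : Fin n → Bool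
    colour = proj₁ bip

    same-colour⇒nonadjacent : ∀ {u v} → colour u ≡ colour v → adj G u v ≡ false
    same-colour⇒nonadjacent {u} {v} same with adj G u v in uv
    ... | true  = contradiction same (proj₂ bip u v uv)
    ... | false = refl

    colour-b : colour b ≡ not (colour a)
    colour-b = ¬-not (proj₂ bip b a (adj-sym ab))

    colour-left : ∀ i → colour (left i) ≡ not (colour a)
    colour-left i = ¬-not (proj₂ bip (left i) a (adj-sym (a~left i)))

    colour-right : ∀ i → colour (right i) ≡ colour a
    colour-right i = trans (¬-not (proj₂ bip (right i) b (adj-sym (b~right i))))
                           (trans (cong not colour-b) (not-involutive (colour a)))

    embed : SV t → Fin n
    embed vx      = a
    embed vy      = b
    embed (vxi i) = right i
    embed (vyi i) = left i

    embed-adj : ∀ u v → adj G (embed u) (embed v) ≡ sAdj u v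
    embed-adj vx      vx       = Graph.irrefl G a
    embed-adj vx      vy       = ab
    embed-adj vx      (vxi i)  = same-colour⇒nonadjacent (sym (colour-right i))
    embed-adj vx      (vyi i)  = a~left i
    embed-adj vy      vx       = adj-sym ab
    embed-adj vy      vy       = Graph.irrefl G b
    embed-adj vy      (vxi i)  = b~right i
    embed-adj vy      (vyi i)  = same-colour⇒nonadjacent (trans colour-b (sym (colour-left i)))
    embed-adj (vxi i) vx       = same-colour⇒nonadjacent (colour-right i)
    embed-adj (vxi i) vy       = adj-sym (b~right i)
    embed-adj (vxi i) (vxi i′) =
      same-colour⇒nonadjacent (trans (colour-right i) (sym (colour-right i′)))
    embed-adj (vxi i) (vyi i′) = trans (Graph.sym G (right i) (left i′)) (nonadjacent i′ i)
    embed-adj (vyi i) vx       = adj-sym (a~left i)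
    embed-adj (vyi i) vy       = same-colour⇒nonadjacent (trans (colour-left i) (sym colour-b))
    embed-adj (vyi i) (vxi i′) = nonadjacent i i′
    embed-adj (vyi i) (vyi i′) =
      same-colour⇒nonadjacent (trans (colour-left i) (sym (colour-left i′)))

    same-row : ∀ u v → embed u ≡ embed v → ∀ w → sAdj u w ≡ sAdj v w
    same-row u v e w =
      trans (sym (embed-adj u w)) (trans (cong (λ x → adj G x (embed w)) e) (embed-adj v w))

    -- Two distinct vertices of S_{t,t} have different neighbourhoods unless both are x_i's or
    -- both are y_i's, so embed-adj forces injectivity everywhere else.
    embed-injective : Injective _≡_ _≡_ embed
    embed-injective {vx}    {vx}     _ = refl
    embed-injective {vx}    {vy}     e with () ← same-row vx vy e vx
    embed-injective {vx}    {vxi i}  e with () ← same-row vx (vxi i) e (vyi i)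
    embed-injective {vx}    {vyi i}  e with () ← same-row vx (vyi i) e vy
    embed-injective {vy}    {vx}     e with () ← same-row vy vx e vx
    embed-injective {vy}    {vy}     _ = refl
    embed-injective {vy}    {vxi i}  e with () ← same-row vy (vxi i) e vx
    embed-injective {vy}    {vyi i}  e with () ← same-row vy (vyi i) e (vxi i)
    embed-injective {vxi i} {vx}     e with () ← same-row (vxi i) vx e (vyi i)
    embed-injective {vxi i} {vy}     e with () ← same-row (vxi i) vy e vx
    embed-injective {vxi i} {vxi i′} e = cong vxi (right-injective e)
    embed-injective {vxi i} {vyi i′} e with () ← same-row (vxi i) (vyi i′) e vy
    embed-injective {vyi i} {vx}     e with () ← same-row (vyi i) vx e vy
    embed-injective {vyi i} {vy}     e with () ← same-row (vyi i) vy e (vxi i)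
    embed-injective {vyi i} {vxi i′} e with () ← same-row (vyi i) (vxi i′) e vy
    embed-injective {vyi i} {vyi i′} e = cong vyi (left-injective e)

  induced-Stt : ∀ {t a b} {T W : Fin n → Bool} → Bipartite G → adj G a b ≡ true →
    (A : Anticomplete T W t t) → (∀ i → adj G a (Anticomplete.left A i) ≡ true) →
    (∀ i → adj G b (Anticomplete.right A i) ≡ true) → InducedStt t G
  induced-Stt bip ab A a~left b~right = embed , embed-injective , embed-adj
    where open DoubleStar bip ab A a~left b~right

  edge⇒induced-S₀₀ : ∀ {a b} → Bipartite G → adj G a b ≡ true → InducedStt 0 G
  edge⇒induced-S₀₀ {a} {b} bip ab = induced-Stt bip ab ∅ (λ ()) (λ ())
    where
    ∅ : Anticomplete (N a) (N b) 0 0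
    ∅ = record
      { left = λ (); right = λ (); left-injective = λ { {()} }; right-injective = λ { {()} }
      ; left⊆T = λ (); right⊆W = λ (); nonadjacent = λ () }

  few-missed-by-some : ∀ {t} .{{_ : NonZero t}} (x : Fin n) (ts : Fin t → Fin n) →
    (∀ i → Far (4 * t) x (ts i) ≡ false) → 4 * count (N x ∖ ⋂ (N ∘ ts)) ≤ deg G x
  few-missed-by-some {t} x ts near = *-cancelˡ-≤ t (begin
    t * (4 * count (N x ∖ ⋂ (N ∘ ts)))  ≤⟨ *-monoʳ-≤ t (*-monoʳ-≤ 4 (count-∖⋂ (N x) (N ∘ ts))) ⟩
    t * (4 * sum missed)                ≡⟨ *-assoc t 4 (sum missed) ⟨
    t * 4 * sum missed                  ≡⟨ cong (_* sum missed) (*-comm t 4) ⟩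
    4 * t * sum missed                  ≡⟨ *-distribˡ-sum (4 * t) missed ⟩
    sum (λ i → 4 * t * missed i)        ≤⟨ sum≤* (λ i → <⇒≤ (¬Far⇒> {4 * t} {x} {ts i} (near i))) ⟩
    t * deg G x                         ∎)
    where
    open ≤-Reasoning
    missed : Fin t → ℕ
    missed i = count (N x ∖ N (ts i))

  common-neighbour : ∀ {t} .{{_ : NonZero t}} (x : Fin n) (ts : Fin t → Fin n) (F : Fin n → Bool) →
    (∀ i → Far (4 * t) x (ts i) ≡ false) → 2 * count (N x ∩ F) < deg G x →
    ∃[ v ] adj G x v ≡ true × F v ≡ false × (∀ i → adj G v (ts i) ≡ true)
  common-neighbour x ts F near few-in-F
    with count∖+count∩<count⇒∃ (N x) (⋂ (N ∘ ts)) F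
           (quarter+half<whole (count (N x ∖ ⋂ (N ∘ ts))) (count (N x ∩ F))
                               (few-missed-by-some x ts near) few-in-F)
  ... | v , v∈ = v , ∧-conicalˡ _ _ in-both , not-injective (∧-conicalʳ _ _ v∈)
               , λ i → adj-sym (⋂-true (N ∘ ts) (∧-conicalʳ _ _ in-both) i)
    where
    in-both = ∧-conicalˡ _ _ v∈

  -- Few far neighbours in S_{t,t}-free graphs

  module _ {t : ℕ} (bip : Bipartite G) (free : InducedSttFree t G) where

    few-far-neighbours : ∀ k {a b} → adj G a b ≡ true → 2 * k * t ≤ deg G b →
                         count (N a ∩ Far k b) < edgeBound t k
    few-far-neighbours k {a} {b} ab margin = ≰⇒> (free ∘ induced)
      where
      far : ∀ s → (N a ∩ Far k b) s ≡ true → deg G b + 2 * k * t ≤ 2 * k * count (N b ∖ N s)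
      far s h = far-margin {k = k} {M = 0} {t = t} (Far⇒≤ {k} {b} {s} (∧-conicalʳ _ _ h)) ≤-refl margin
      induced : edgeBound t k ≤ count (N a ∩ Far k b) → InducedStt t G
      induced big = induced-Stt bip ab A (λ i → ∧-conicalˡ _ _ (left⊆T i)) right⊆W
        where
        A = anticomplete-greedy t (N a ∩ Far k b) (N b) (∈⇒0<count (N b) a (adj-sym ab)) ≤-refl far big
        open Anticomplete A

    few-far-neighbours-via : .{{_ : NonZero t}} → ∀ k {M₁ M₆} (x₁ x₂ x₅ x₆ : Fin n) →
      2 * count (N x₂ ∩ Far 2 x₅) < deg G x₂ →
      count (N x₁ ∩ Far (4 * t) x₂) ≤ M₁ → count (N x₆ ∩ Far (4 * t) x₅) ≤ M₆ →
      1 ≤ deg G x₆ → 2 * k * (M₆ + t) ≤ deg G x₆ →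
      count (N x₁ ∩ Far k x₆) < M₁ + edgeBound t k
    few-far-neighbours-via k {M₁} {M₆} x₁ x₂ x₅ x₆ x₂-few x₁-few x₆-few deg≥1 margin =
      ≰⇒> (free ∘ induced)
      where
      T₀ W₀ : Fin n → Bool
      T₀ = N x₁ ∩ Far k x₆ ∖ Far (4 * t) x₂
      W₀ = N x₆ ∖ Far (4 * t) x₅
      T₀-far : ∀ s → T₀ s ≡ true → deg G x₆ + 2 * k * t ≤ 2 * k * count (W₀ ∖ N s)
      T₀-far s h = far-margin {k = k} {M = M₆} {t = t}
        (Far⇒≤ {k} {x₆} {s} (∧-conicalʳ (N x₁ s) _ (∧-conicalˡ (N x₁ s ∧ Far k x₆ s) _ h)))
        (≤-trans (count-∖≤∩+∖∖ (N x₆) (Far (4 * t) x₅) (N s)) (+-monoˡ-≤ _ x₆-few)) margin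
      T₀-big : M₁ + edgeBound t k ≤ count (N x₁ ∩ Far k x₆) → edgeBound t k ≤ count T₀
      T₀-big big = +-cancelˡ-≤ M₁ _ _ (begin
        M₁ + edgeBound t k                                   ≤⟨ big ⟩
        count (N x₁ ∩ Far k x₆)                              ≡⟨ count-split _ (Far (4 * t) x₂) ⟩
        count (N x₁ ∩ Far k x₆ ∩ Far (4 * t) x₂) + count T₀  ≤⟨ +-monoˡ-≤ _ x₁-near-x₂ ⟩
        M₁ + count T₀                                        ∎)
        where
        open ≤-Reasoning
        x₁-near-x₂ : count (N x₁ ∩ Far k x₆ ∩ Far (4 * t) x₂) ≤ M₁
        x₁-near-x₂ = ≤-trans (count-mono λ v h →
          cong₂ _∧_ (∧-conicalˡ (N x₁ v) _ (∧-conicalˡ (N x₁ v ∧ Far k x₆ v) _ h))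
                    (∧-conicalʳ (N x₁ v ∧ Far k x₆ v) _ h)) x₁-few
      complete : Anticomplete T₀ W₀ t t → InducedStt t G
      complete A = pick-a (common-neighbour x₂ left (Far 2 x₅)
                             (λ i → not-injective (∧-conicalʳ _ _ (left⊆T i))) x₂-few)
        where
        open Anticomplete A
        pick-b : ∀ {a} → (∀ i → adj G a (left i) ≡ true) →
          ∃[ b ] adj G x₅ b ≡ true × not (adj G a b) ≡ false × (∀ i → adj G b (right i) ≡ true) →
          InducedStt t G
        pick-b a~left (b , _ , a~b , b~right) = induced-Stt bip (not-injective a~b) A a~left b~right
        pick-a : ∃[ a ] adj G x₂ a ≡ true × Far 2 x₅ a ≡ false × (∀ i → adj G a (left i) ≡ true) →
                 InducedStt t G
        pick-a (a , _ , a-near , a~left) =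
          pick-b a~left (common-neighbour x₅ right (λ v → not (adj G a v))
                           (λ i → not-injective (∧-conicalʳ _ _ (right⊆W i)))
                           (¬Far⇒> {2} {x₅} {a} a-near))
      induced : M₁ + edgeBound t k ≤ count (N x₁ ∩ Far k x₆) → InducedStt t G
      induced big = complete (anticomplete-greedy t T₀ W₀ deg≥1 W₀≤deg T₀-far (T₀-big big))
        where
        W₀≤deg : count W₀ ≤ deg G x₆
        W₀≤deg = count-mono (λ v → ∧-conicalˡ (N x₆ v) _)

    few-far-along-path : .{{_ : NonZero t}} → ∀ {k δ} (p : Fin 6 → Fin n) → IsPath6 G p →
      (∀ v → δ ≤ deg G v) → All (_≤ δ) (degreeThresholds t k) →
      count (N (p 0F) ∩ Far k (p 5F)) < pathBound t k
    few-far-along-path {k} {δ} p (_ , edge) δ≤deg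
      (1≤δ All.∷ edge-4t All.∷ edge-2 All.∷ x₃-2 All.∷ x₅-2 All.∷ x₂-2 All.∷ x₆-k All.∷ All.[]) =
      few-far-neighbours-via k (p 0F) (p 1F) (p 4F) (p 5F) x₂-few
        (<⇒≤ (few-far-neighbours (4 * t) (edge 0F) (≥δ edge-4t)))
        (<⇒≤ (few-far-neighbours (4 * t) (adj-sym (edge 4F)) (≥δ edge-4t)))
        (≥δ 1≤δ) (≥δ x₆-k)
      where
      ≥δ : ∀ {c v} → c ≤ δ → c ≤ deg G v
      ≥δ {v = v} c≤δ = ≤-trans c≤δ (δ≤deg v)
      twice< : ∀ {c E v} → c < E → 2 * E ≤ δ → 2 * c < deg G v
      twice< c<E 2E≤δ = <-≤-trans (*-monoʳ-< 2 c<E) (≥δ 2E≤δ)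
      x₃-few : 2 * count (N (p 2F) ∩ Far 2 (p 3F)) < deg G (p 2F)
      x₃-few = twice< (few-far-neighbours 2 (edge 2F) (≥δ edge-2)) x₃-2
      x₂-few : 2 * count (N (p 1F) ∩ Far 2 (p 4F)) < deg G (p 1F)
      x₂-few = twice< (few-far-neighbours-via 2 (p 1F) (p 2F) (p 3F) (p 4F) x₃-few
                        (<⇒≤ (few-far-neighbours (4 * t) (edge 1F) (≥δ edge-4t)))
                        (<⇒≤ (few-far-neighbours (4 * t) (adj-sym (edge 3F)) (≥δ edge-4t)))
                        (≥δ 1≤δ) (≥δ x₅-2)) x₂-2

xs≤sum : ∀ xs → All (_≤ ListAction.sum xs) xs
xs≤sum []       = All.[]
xs≤sum (x ∷ xs) = m≤m+n x _ All.∷ All.map (λ x′≤ → ≤-trans x′≤ (m≤n+m _ x)) (xs≤sum xs)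

C4 : ℕ → ℚ → ℕ
C4 t ε = ListAction.sum (pathBound t (↧ₙ ε) ∷ degreeThresholds t (↧ₙ ε))

C4-bounds : ∀ t ε → All (_≤ C4 t ε) (pathBound t (↧ₙ ε) ∷ degreeThresholds t (↧ₙ ε))
C4-bounds t ε = xs≤sum (pathBound t (↧ₙ ε) ∷ degreeThresholds t (↧ₙ ε))

lemma1p11 : Σ (ℕ → ℚ → ℕ) λ C4 →
    ∀ (t : ℕ) (ε : ℚ) → 0ℚ ℚ.< ε → ε ℚ.< 1ℚ →
    ∀ (n : ℕ) (G : Graph n) → Bipartite G → InducedSttFree t G →
    (∀ v → C4 t ε ≤ deg G v) →
    ∀ (p : Fin 6 → Fin n) → IsPath6 G p →
    sizeS G ε (p zero) (p (suc (suc (suc (suc (suc zero)))))) ≤ C4 t ε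
lemma1p11 = C4 , λ where
  zero ε _ _ n G bip free _ p (_ , edge) → ⊥-elim (free (edge⇒induced-S₀₀ G bip (edge 0F)))
  (suc t) ε ε>0 _ n G bip free C4≤deg p path → let open ≤-Reasoning in begin
    sizeS G ε (p 0F) (p 5F)                   ≤⟨ sizeS≤count-Far G ε>0 (p 0F) (p 5F) ⟩
    count (N G (p 0F) ∩ Far G (↧ₙ ε) (p 5F))  <⟨ few-far-along-path G bip free p path C4≤deg
                                                   (All.tail (C4-bounds (suc t) ε)) ⟩
    pathBound (suc t) (↧ₙ ε)                  ≤⟨ All.head (C4-bounds (suc t) ε) ⟩
    C4 (suc t) ε                              ∎
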